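{- Let $r\in\{\beta,\beta\eta,h\}$ and let $\mathcal I$ be an $r$-interpretation. (1)(a) For every $U\in\mathbb U$, $\mathcal I(U)$ is $r$-saturated. (1)(b) If $d(U)=L$, then for all $x\in\mathcal V_1$, $\mathcal N^L_x\subseteq\mathcal I(U)\subseteq\mathcal M^L$. (2) If $U\sqsubseteq V$, then $\mathcal I(U)\subseteq\mathcal I(V)$.
   Context: Indexes: finite sequences of natural numbers ($\mathcal L_{\mathbb N}$), $\oslash$ empty, $i::L$ prepending $i$, $L_1\preceq L_2$ (also $L_2\succeq L_1$) iff $L_2=L_1::L_3$ for some $L_3$ (concatenation). Terms: over a countably infinite set $\mathcal V=\mathcal V_1\cup\mathcal V_2$ of variables ($\mathcal V_1,\mathcal V_2$ disjoint and countably infinite), terms $\mathcal M$, free indexed variables $\mathrm{fv}$, degree $d$, joinability $\diamond$ defined simultaneously: $x^L\in\mathcal M$ ($\mathrm{fv}=\{x^L\}$, $d=L$); $MN\in\mathcal M$ when $d(M)\preceq d(N)$, $M\diamond N$ ($\mathrm{fv}$ union, $d(MN)=d(M)$); $\lambda x^L.M\in\mathcal M$ when $L\succeq d(M)$ ($\mathrm{fv}(M)\setminus\{x^L\}$, $d=d(M)$). $M\diamond N$ iff $x^L\in\mathrm{fv}(M)$, $x^K\in\mathrm{fv}(N)$ imply $L=K$. Terms modulo $\alpha$; $M[x^L:=N]$ defined only if $M\diamond N$, $d(N)=L$. $\rhd_\beta$: least relation compatible with abstraction and application containing $(\lambda x^L.M)N\rhd_\beta M[x^L:=N]$ ($d(N)=L$);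 $\rhd_\eta$: from $\lambda x^L.(Mx^L)\rhd_\eta M$ ($x^L\notin\mathrm{fv}(M)$); $\rhd_{\beta\eta}=\rhd_\beta\cup\rhd_\eta$; $(\lambda x^L.M)NN_1\dots N_n\rhd_hM[x^L:=N]N_1\dots N_n$; $\rhd^*_r$ reflexive–transitive closure. Lifting $(x^L)^{+i}=x^{i::L}$, $(M_1M_2)^{+i}=M_1^{+i}M_2^{+i}$, $(\lambda x^L.M)^{+i}=\lambda x^{i::L}.M^{+i}$. Types: atomic types $\mathcal A$, expansion variables $\overline e_0,\overline e_1,\dots$; $\mathbb T\subseteq\mathbb U$ with degree: $a\in\mathbb T$ ($d=\oslash$); $U\to T\in\mathbb T$ for $U\in\mathbb U,T\in\mathbb T$ ($d=\oslash$); $\omega^L\in\mathbb U$ ($d=L$); $U_1\sqcap U_2$ if $d(U_1)=d(U_2)$; $\overline e_iU$ ($d=i::d(U)$); modulo $\sqcap$ commutative, associative, idempotent, $\overline e_i(U_1\sqcap U_2)=\overline e_iU_1\sqcap\overline e_iU_2$, $\omega^L\sqcap U=U$ ($d(U)=L$), $\overline e_i\omega^K=\omega^{i::K}$. Subtyping $\sqsubseteq$ on types: least relation closed under reflexivity, transitivity, $U_1\sqcap U_2\sqsubseteq U_1$ ($d(U_1)=d(U_2)$), $U_1\sqcap U_2\sqsubseteq V_1\sqcap V_2$ if $U_i\sqsubseteq V_i$, $U_1\to T_1\sqsubseteq U_2\to T_2$ if $U_2\sqsubseteq U_1$ and $T_1\sqsubseteq T_2$, $\overline e_iU_1\sqsubseteq\overline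 e_iU_2$ if $U_1\sqsubseteq U_2$. Realisability: $\mathcal X^{+i}=\{M^{+i}:M\in\mathcal X\}$; $\mathcal X\leadsto\mathcal Y=\{M\in\mathcal M: MN\in\mathcal Y$ for all $N\in\mathcal X$ with $M\diamond N\}$; $\mathcal X$ is $r$-saturated if $M\rhd^*_rN\in\mathcal X$ implies $M\in\mathcal X$. $\mathcal M^L=\{M\in\mathcal M:d(M)=L\}$; for $x\in\mathcal V_1$, $\mathcal N^L_x=\{x^LN_1\dots N_k\in\mathcal M:k\ge0\}$. An $r$-interpretation is a map $\mathcal I:\mathcal A\to\mathcal P(\mathcal M^\oslash)$ such that each $\mathcal I(a)$ is $r$-saturated and $\mathcal N^\oslash_x\subseteq\mathcal I(a)$ for all $x\in\mathcal V_1$; it is extended to $\mathbb U$ by $\mathcal I(\omega^L)=\mathcal M^L$, $\mathcal I(\overline e_iU)=\mathcal I(U)^{+i}$, $\mathcal I(U_1\sqcap U_2)=\mathcal I(U_1)\cap\mathcal I(U_2)$, $\mathcal I(U\to T)=\mathcal I(U)\leadsto\mathcal I(T)$. -}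

module Defs where

open import Level using (0ℓ)
open import Data.Nat using (ℕ; zero; suc; pred; _<ᵇ_; _≡ᵇ_)
open import Data.Bool using (if_then_else_)
open import Data.List using (List; []; _∷_; _++_)
open import Data.List.Membership.Propositional using (_∈_)
open import Data.Product using (Σ; ∃; _×_; _,_)
open import Relation.Unary using (Pred; _⊆_)
open import Relation.Binary.PropositionalEquality using (_≡_)
open import Relation.Binary.Construct.Closure.ReflexiveTransitive using (Star)

Index : Set
Index = List ℕ

-- L₁ ⪯ L₂  iff  L₂ = L₁ ++ L₃ for some L₃   (L₂ ⪰ L₁ is written L₁ ⪯ L₂)
_⪯_ : Index → Index → Set
L₁ ⪯ L₂ = ∃ λ L₃ → L₂ ≡ L₁ ++ L₃

-- Variables:  𝒱 = 𝒱₁ ∪ 𝒱₂, disjoint, both countably infinite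

data Var : Set where
  v₁ : ℕ → Var
  v₂ : ℕ → Var

data IsV₁ : Var → Set where
  isV₁ : ∀ n → IsV₁ (v₁ n)

-- Raw terms, locally nameless: free indexed variables x^L are named,
-- bound variables are de Bruijn indices carrying their index label.
-- α-equivalence classes of (well-formed) terms correspond exactly to the
-- well-formed raw terms below.

data Tm : Set where
  var  : Var → Index → Tm
  bvar : ℕ → Index → Tm
  app  : Tm → Tm → Tm
  lam  : Index → Tm → Tm

deg : Tm → Index
deg (var x L)  = L
deg (bvar n L) = L
deg (app M N)  = deg M
deg (lam L M)  = deg M

fvs : Tm → List (Var × Index)
fvs (var x L)  = (x , L) ∷ []
fvs (bvar n L) = []
fvs (app M N)  = fvs M ++ fvs N
fvs (lam L M)  = fvs M

_⋄_ : Tm → Tm → Set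
M ⋄ N = ∀ x L K → (x , L) ∈ fvs M → (x , K) ∈ fvs N → L ≡ K

data _∋_∶_ : List Index → ℕ → Index → Set where
  here  : ∀ {Γ L} → (L ∷ Γ) ∋ zero ∶ L
  there : ∀ {Γ K n L} → Γ ∋ n ∶ L → (K ∷ Γ) ∋ suc n ∶ L

-- well-formedness (the formation rules of 𝓜), Γ = indexes of enclosing binders
data WF (Γ : List Index) : Tm → Set where
  wvar  : ∀ {x L} → WF Γ (var x L)
  wbvar : ∀ {n L} → Γ ∋ n ∶ L → WF Γ (bvar n L)
  wapp  : ∀ {M N} → WF Γ M → WF Γ N → deg M ⪯ deg N → M ⋄ N → WF Γ (app M N)
  wlam  : ∀ {L M} → WF (L ∷ Γ) M → deg M ⪯ L → WF Γ (lam L M)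

Term : Tm → Set
Term = WF []

lift : ℕ → Tm → Tm
lift i (var x L)  = var x (i ∷ L)
lift i (bvar n L) = bvar n (i ∷ L)
lift i (app M N)  = app (lift i M) (lift i N)
lift i (lam L M)  = lam (i ∷ L) (lift i M)

shift : ℕ → Tm → Tm
shift c (var x L)  = var x L
shift c (bvar n L) = if n <ᵇ c then bvar n L else bvar (suc n) L
shift c (app M N)  = app (shift c M) (shift c N)
shift c (lam L M)  = lam L (shift (suc c) M)

substB : ℕ → Tm → Tm → Tm
substB k N (var x L)  = var x L
substB k N (bvar n L) =
  if n <ᵇ k then bvar n L else (if n ≡ᵇ k then N else bvar (pred n) L)
substB k N (app M P)  = app (substB k N M) (substB k N P)
substB k N (lam L M)  = lam L (substB (suc k) (shift 0 N) M)

data βbase : Tm → Tm → Set where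
  β : ∀ {L M N} → deg N ≡ L → βbase (app (lam L M) N) (substB 0 N M)

-- λx^L.(M x^L) ↦ M  when x^L ∉ fv(M)  (shift 0 M : M does not use the binder)
data ηbase : Tm → Tm → Set where
  η : ∀ {L M} → ηbase (lam L (app (shift 0 M) (bvar 0 L))) M

data Compat (R : Tm → Tm → Set) : Tm → Tm → Set where
  base : ∀ {M N} → R M N → Compat R M N
  appL : ∀ {M M' N} → Compat R M M' → Compat R (app M N) (app M' N)
  appR : ∀ {M N N'} → Compat R N N' → Compat R (app M N) (app M N')
  lamC : ∀ {L M M'} → Compat R M M' → Compat R (lam L M) (lam L M')

_▷β_ : Tm → Tm → Set
_▷β_ = Compat βbase

_▷η_ : Tm → Tm → Set
_▷η_ = Compat ηbase

_▷βη_ : Tm → Tm → Set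
M ▷βη N = (M ▷β N) Data.Sum.⊎ (M ▷η N)
  where import Data.Sum

data _▷h_ : Tm → Tm → Set where
  hβ   : ∀ {L M N} → deg N ≡ L → app (lam L M) N ▷h substB 0 N M
  happ : ∀ {M M' P} → M ▷h M' → app M P ▷h app M' P

data Red : Set where
  rβ rβη rh : Red

_⊢_▷_ : Red → Tm → Tm → Set
rβ  ⊢ M ▷ N = M ▷β N
rβη ⊢ M ▷ N = M ▷βη N
rh  ⊢ M ▷ N = M ▷h N

_⊢_▷*_ : Red → Tm → Tm → Set
r ⊢ M ▷* N = Star (r ⊢_▷_) M N

Saturated : Red → Pred Tm 0ℓ → Set
Saturated r X = ∀ M N → Term M → r ⊢ M ▷* N → X N → X M

𝓜^ : Index → Pred Tm 0ℓ
𝓜^ L M = Term M × deg M ≡ L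

apps : Tm → List Tm → Tm
apps M []       = M
apps M (N ∷ Ns) = apps (app M N) Ns

𝓝 : Var → Index → Pred Tm 0ℓ
𝓝 x L M = Term M × ∃ λ Ns → M ≡ apps (var x L) Ns

_⁺_ : Pred Tm 0ℓ → ℕ → Pred Tm 0ℓ
(X ⁺ i) M = ∃ λ N → X N × M ≡ lift i N

_⇝_ : Pred Tm 0ℓ → Pred Tm 0ℓ → Pred Tm 0ℓ
(X ⇝ Y) M = Term M × (∀ N → X N → M ⋄ N → Y (app M N))

infixr 6 _⇒_
infixl 7 _⊓_

data Ty : Set where
  atom : ℕ → Ty
  _⇒_  : Ty → Ty → Ty
  ω    : Index → Ty
  _⊓_  : Ty → Ty → Ty
  ē    : ℕ → Ty → Ty

tdeg : Ty → Index
tdeg (atom a) = []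
tdeg (U ⇒ T)  = []
tdeg (ω L)    = L
tdeg (U ⊓ V)  = tdeg U
tdeg (ē i U)  = i ∷ tdeg U

data IsT : Ty → Set where
  tatom : ∀ a → IsT (atom a)
  tarr  : ∀ U T → IsT (U ⇒ T)

data WfTy : Ty → Set where
  watom : ∀ a → WfTy (atom a)
  warr  : ∀ {U T} → WfTy U → WfTy T → IsT T → WfTy (U ⇒ T)
  wω    : ∀ L → WfTy (ω L)
  w⊓    : ∀ {U V} → WfTy U → WfTy V → tdeg U ≡ tdeg V → WfTy (U ⊓ V)
  wē    : ∀ {i U} → WfTy U → WfTy (ē i U)

-- the equational theory types are taken modulo (on well-formed types)
data _≃_ : Ty → Ty → Set where
  ≃refl  : ∀ {U} → WfTy U → U ≃ U
  ≃sym   : ∀ {U V} → U ≃ V → V ≃ U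
  ≃trans : ∀ {U V W} → U ≃ V → V ≃ W → U ≃ W
  ⊓cong  : ∀ {U₁ U₂ V₁ V₂} → U₁ ≃ V₁ → U₂ ≃ V₂ → tdeg U₁ ≡ tdeg U₂ →
           (U₁ ⊓ U₂) ≃ (V₁ ⊓ V₂)
  ēcong  : ∀ {i U V} → U ≃ V → ē i U ≃ ē i V
  ⇒cong  : ∀ {U₁ U₂ T₁ T₂} → U₁ ≃ U₂ → T₁ ≃ T₂ → IsT T₁ → IsT T₂ →
           (U₁ ⇒ T₁) ≃ (U₂ ⇒ T₂)
  ⊓comm  : ∀ {U₁ U₂} → WfTy (U₁ ⊓ U₂) → (U₁ ⊓ U₂) ≃ (U₂ ⊓ U₁)
  ⊓assoc : ∀ {U₁ U₂ U₃} → WfTy ((U₁ ⊓ U₂) ⊓ U₃) →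
           ((U₁ ⊓ U₂) ⊓ U₃) ≃ (U₁ ⊓ (U₂ ⊓ U₃))
  ⊓idem  : ∀ {U} → WfTy U → (U ⊓ U) ≃ U
  ēdist  : ∀ {i U₁ U₂} → WfTy (U₁ ⊓ U₂) → ē i (U₁ ⊓ U₂) ≃ (ē i U₁ ⊓ ē i U₂)
  ωunit  : ∀ {L U} → WfTy U → tdeg U ≡ L → (ω L ⊓ U) ≃ U
  ēω     : ∀ {i K} → ē i (ω K) ≃ ω (i ∷ K)

data _⊑_ : Ty → Ty → Set where
  ⊑≃     : ∀ {U V} → U ≃ V → U ⊑ V
  ⊑refl  : ∀ {U} → WfTy U → U ⊑ U
  ⊑trans : ∀ {U V W} → U ⊑ V → V ⊑ W → U ⊑ W
  ⊓elim  : ∀ {U₁ U₂} → WfTy (U₁ ⊓ U₂) → (U₁ ⊓ U₂) ⊑ U₁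
  ⊓mono  : ∀ {U₁ U₂ V₁ V₂} → U₁ ⊑ V₁ → U₂ ⊑ V₂ → tdeg U₁ ≡ tdeg U₂ →
           tdeg V₁ ≡ tdeg V₂ → (U₁ ⊓ U₂) ⊑ (V₁ ⊓ V₂)
  ⇒mono  : ∀ {U₁ U₂ T₁ T₂} → U₂ ⊑ U₁ → T₁ ⊑ T₂ → IsT T₁ → IsT T₂ →
           (U₁ ⇒ T₁) ⊑ (U₂ ⇒ T₂)
  ēmono  : ∀ {i U₁ U₂} → U₁ ⊑ U₂ → ē i U₁ ⊑ ē i U₂

record Interp (r : Red) : Set₁ where
  field
    I      : ℕ → Pred Tm 0ℓ
    I⊆𝓜∅  : ∀ a → I a ⊆ 𝓜^ []
    I-sat  : ∀ a → Saturated r (I a)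
    I-neut : ∀ a x → IsV₁ x → 𝓝 x [] ⊆ I a

⟦_⟧ : ∀ {r} → Interp r → Ty → Pred Tm 0ℓ
⟦ 𝓘 ⟧ (atom a) = Interp.I 𝓘 a
⟦ 𝓘 ⟧ (U ⇒ T)  = (⟦ 𝓘 ⟧ U) ⇝ (⟦ 𝓘 ⟧ T)
⟦ 𝓘 ⟧ (ω L)    = 𝓜^ L
⟦ 𝓘 ⟧ (U ⊓ V)  = λ M → ⟦ 𝓘 ⟧ U M × ⟦ 𝓘 ⟧ V M
⟦ 𝓘 ⟧ (ē i U)  = (⟦ 𝓘 ⟧ U) ⁺ i

module Submission where

-- The two
--      interesting cases are  ē_i U, where one needs that every term of degree
--      i ∷ K is the lift of a term of degree K, and  U → T, where a term of
--      𝓘(U → T) is applied to a fresh variable of 𝓥₁ (which lies in 𝓘(U)).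
-- (1a) Saturation, by induction on U.  It rests on subject reduction (a reduct
--      of a term is a term of the same degree with no new free variables) and
--      on the fact that reduction commutes with stripping the head of every
--      index (unlifting), which handles the case ē_i U.
-- (2)  Monotonicity of 𝓘 along ⊑, by induction on the subtyping derivation,
--      after showing that equal types (≃) have equal interpretations.

open import Defs
open import Data.Product using (_×_)
open import Relation.Unary using (_⊆_)
open import Relation.Binary.PropositionalEquality using (_≡_)

open import Function using (id)
open import Data.Nat using (ℕ; zero; suc; pred; _<ᵇ_; _≡ᵇ_; _+_; _<_; s≤s)
open import Data.Nat.Properties using (m≤m+n; m≤n+m; ≤-trans; <-irrefl)
open import Data.Bool using (true; false; if_then_else_)
open import Data.List using (List; []; _∷_; _++_; length; map)
open import Data.List.Properties using (map-++)
open import Data.List.Membership.Propositional using (_∈_)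
open import Data.List.Membership.Propositional.Properties using (∈-++⁻; ∈-map⁻)
open import Data.List.Relation.Unary.Any using (here; there)
open import Data.List.Relation.Binary.Subset.Propositional using ()
  renaming (_⊆_ to _⊆ₗ_)
open import Data.List.Relation.Binary.Subset.Propositional.Properties
  using (⊆-refl; ⊆-reflexive; ⊆-trans; xs⊆xs++ys; xs⊆ys++xs; ++⁺ˡ; ++⁺ʳ)
open import Data.Product using (_,_; proj₁; proj₂; map₂)
open import Data.Sum using (inj₁; inj₂)
open import Data.Empty using (⊥-elim)
open import Relation.Unary using (_≐_)
open import Relation.Binary.PropositionalEquality
  using (refl; sym; trans; cong; cong₂; subst; subst₂; module ≡-Reasoning)
open import Relation.Binary.Construct.Closure.ReflexiveTransitive using (ε; _◅_; gmap)

-- Joinability of lists of indexed variables;  M ⋄ N  unfolds to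
-- Joinable (fvs M) (fvs N), so the lemmas below apply to terms directly.
FVs : Set
FVs = List (Var × Index)

Joinable : FVs → FVs → Set
Joinable xs ys = ∀ x L K → (x , L) ∈ xs → (x , K) ∈ ys → L ≡ K

⋄-mono : ∀ {xs xs' ys ys'} → xs' ⊆ₗ xs → ys' ⊆ₗ ys → Joinable xs ys → Joinable xs' ys'
⋄-mono s t j x L K a b = j x L K (s a) (t b)

⋄-sym : ∀ {xs ys} → Joinable xs ys → Joinable ys xs
⋄-sym j x L K a b = sym (j x K L b a)

⋄-app : ∀ {xs ys zs} → Joinable xs zs → Joinable ys zs → Joinable (xs ++ ys) zs
⋄-app {xs} jx jy x L K a b with ∈-++⁻ xs a
... | inj₁ a' = jx x L K a' b
... | inj₂ a' = jy x L K a' b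

⋄-appʳ : ∀ {xs ys zs} → Joinable zs xs → Joinable zs ys → Joinable zs (xs ++ ys)
⋄-appʳ jx jy = ⋄-sym (⋄-app (⋄-sym jx) (⋄-sym jy))

⋄-app⁻ˡ : ∀ {xs ys zs} → Joinable (xs ++ ys) zs → Joinable xs zs
⋄-app⁻ˡ {xs} {ys} = ⋄-mono (xs⊆xs++ys xs ys) ⊆-refl

⋄-app⁻ʳ : ∀ {xs ys zs} → Joinable (xs ++ ys) zs → Joinable ys zs
⋄-app⁻ʳ {xs} {ys} = ⋄-mono (xs⊆ys++xs ys xs) ⊆-refl

self⋄ : ∀ {Γ M} → WF Γ M → M ⋄ M
self⋄ wvar x L K (here refl) (here refl) = refl
self⋄ (wbvar _) x L K ()
self⋄ (wapp wM wN _ j) = ⋄-app (⋄-appʳ (self⋄ wM) j) (⋄-appʳ (⋄-sym j) (self⋄ wN))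
self⋄ (wlam wM _) = self⋄ wM

fvs-shift : ∀ c M → fvs (shift c M) ≡ fvs M
fvs-shift c (var x L) = refl
fvs-shift c (bvar n L) with n <ᵇ c
... | true  = refl
... | false = refl
fvs-shift c (app M N) = cong₂ _++_ (fvs-shift c M) (fvs-shift c N)
fvs-shift c (lam L M) = fvs-shift (suc c) M

deg-shift : ∀ c M → deg (shift c M) ≡ deg M
deg-shift c (var x L) = refl
deg-shift c (bvar n L) with n <ᵇ c
... | true  = refl
... | false = refl
deg-shift c (app M N) = deg-shift c M
deg-shift c (lam L M) = deg-shift (suc c) M

weaken-var : ∀ Δ {Γ K n L} → (Δ ++ Γ) ∋ n ∶ L →
  WF (Δ ++ K ∷ Γ) (shift (length Δ) (bvar n L))
weaken-var [] p = wbvar (there p)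
weaken-var (_ ∷ Δ) here = wbvar here
weaken-var (_ ∷ Δ) {n = suc m} (there p) with m <ᵇ length Δ | weaken-var Δ p
... | true  | wbvar q = wbvar (there q)
... | false | wbvar q = wbvar (there q)

weaken : ∀ Δ {Γ K M} → WF (Δ ++ Γ) M → WF (Δ ++ K ∷ Γ) (shift (length Δ) M)
weaken Δ wvar = wvar
weaken Δ (wbvar p) = weaken-var Δ p
weaken Δ (wapp {M} {N} wM wN d j) =
  wapp (weaken Δ wM) (weaken Δ wN)
    (subst₂ _⪯_ (sym (deg-shift _ M)) (sym (deg-shift _ N)) d)
    (⋄-mono (⊆-reflexive (fvs-shift _ M)) (⊆-reflexive (fvs-shift _ N)) j)
weaken Δ (wlam {L} {M} wM d) =
  wlam (weaken (L ∷ Δ) wM) (subst (_⪯ L) (sym (deg-shift _ M)) d)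

unthere-shifted : ∀ b {Γ K n L} →
  WF (K ∷ Γ) (if b then bvar (suc n) L else bvar (suc (suc n)) L) →
  WF Γ (if b then bvar n L else bvar (suc n) L)
unthere-shifted true  (wbvar (there p)) = wbvar p
unthere-shifted false (wbvar (there p)) = wbvar p

unweaken-var : ∀ Δ {Γ K n L} → WF (Δ ++ K ∷ Γ) (shift (length Δ) (bvar n L)) →
  (Δ ++ Γ) ∋ n ∶ L
unweaken-var [] (wbvar (there p)) = p
unweaken-var (_ ∷ Δ) {n = zero} (wbvar here) = here
unweaken-var (_ ∷ Δ) {n = suc m} w =
  there (unweaken-var Δ (unthere-shifted (m <ᵇ length Δ) w))

strengthen : ∀ Δ {Γ K} M → WF (Δ ++ K ∷ Γ) (shift (length Δ) M) → WF (Δ ++ Γ) M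
strengthen Δ (var x L) w = wvar
strengthen Δ (bvar n L) w = wbvar (unweaken-var Δ w)
strengthen Δ (app M N) (wapp wM wN d j) =
  wapp (strengthen Δ M wM) (strengthen Δ N wN)
    (subst₂ _⪯_ (deg-shift _ M) (deg-shift _ N) d)
    (⋄-mono (⊆-reflexive (sym (fvs-shift _ M))) (⊆-reflexive (sym (fvs-shift _ N))) j)
strengthen Δ (lam L M) (wlam w d) =
  wlam (strengthen (L ∷ Δ) M w) (subst (_⪯ L) (deg-shift _ M) d)

lookup-below : ∀ Δ {X Y n L'} → (n <ᵇ length Δ) ≡ true →
  (Δ ++ X) ∋ n ∶ L' → (Δ ++ Y) ∋ n ∶ L'
lookup-below (K ∷ Δ) below here = here
lookup-below (K ∷ Δ) below (there p) = there (lookup-below Δ below p)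

lookup-at : ∀ Δ {L Γ n L'} → (n ≡ᵇ length Δ) ≡ true →
  (Δ ++ L ∷ Γ) ∋ n ∶ L' → L' ≡ L
lookup-at [] at here = refl
lookup-at (K ∷ Δ) at (there p) = lookup-at Δ at p

lookup-above : ∀ Δ {L Γ n L'} → (n <ᵇ length Δ) ≡ false → (n ≡ᵇ length Δ) ≡ false →
  (Δ ++ L ∷ Γ) ∋ n ∶ L' → (Δ ++ Γ) ∋ pred n ∶ L'
lookup-above [] below () here
lookup-above [] below at (there p) = p
lookup-above (K ∷ []) {n = suc zero} below () (there p)
lookup-above (K ∷ K' ∷ Δ) {n = suc zero} () at (there p)
lookup-above (K ∷ Δ) {n = suc (suc m)} below at (there p) =
  there (lookup-above Δ below at p)

fvs-subst : ∀ k P M → fvs (substB k P M) ⊆ₗ fvs M ++ fvs P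
fvs-subst k P (var x L) = xs⊆xs++ys _ _
fvs-subst k P (bvar n L) with n <ᵇ k | n ≡ᵇ k
... | true  | _     = λ ()
... | false | true  = id
... | false | false = λ ()
fvs-subst k P (app M N) a with ∈-++⁻ (fvs (substB k P M)) a
... | inj₁ b = ++⁺ˡ (fvs P) (xs⊆xs++ys (fvs M) (fvs N)) (fvs-subst k P M b)
... | inj₂ b = ++⁺ˡ (fvs P) (xs⊆ys++xs (fvs N) (fvs M)) (fvs-subst k P N b)
fvs-subst k P (lam L M) =
  ⊆-trans (fvs-subst (suc k) (shift 0 P) M)
          (⊆-reflexive (cong (fvs M ++_) (fvs-shift 0 P)))

subst-wf-var : ∀ Δ {Γ L P n L'} → (Δ ++ L ∷ Γ) ∋ n ∶ L' →
  WF (Δ ++ Γ) P → deg P ≡ L →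
  WF (Δ ++ Γ) (substB (length Δ) P (bvar n L')) ×
  deg (substB (length Δ) P (bvar n L')) ≡ L'
subst-wf-var Δ {n = n} p wP dP with n <ᵇ length Δ in below | n ≡ᵇ length Δ in at
... | true  | _     = wbvar (lookup-below Δ below p) , refl
... | false | true  = wP , trans dP (sym (lookup-at Δ at p))
... | false | false = wbvar (lookup-above Δ below at p) , refl

subst-wf : ∀ Δ {Γ L P M} → WF (Δ ++ L ∷ Γ) M → WF (Δ ++ Γ) P → deg P ≡ L →
  M ⋄ P → P ⋄ P →
  WF (Δ ++ Γ) (substB (length Δ) P M) × deg (substB (length Δ) P M) ≡ deg M
subst-wf Δ wvar wP dP jMP jPP = wvar , refl
subst-wf Δ (wbvar p) wP dP jMP jPP = subst-wf-var Δ p wP dP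
subst-wf Δ {P = P} (wapp {M} {N} wM wN d j) wP dP jMP jPP =
  wapp (proj₁ IHM) (proj₁ IHN) (subst₂ _⪯_ (sym (proj₂ IHM)) (sym (proj₂ IHN)) d) joinable ,
  proj₂ IHM
  where
    jM : M ⋄ P
    jM = ⋄-app⁻ˡ jMP
    jN : N ⋄ P
    jN = ⋄-app⁻ʳ jMP
    IHM = subst-wf Δ wM wP dP jM jPP
    IHN = subst-wf Δ wN wP dP jN jPP
    -- the pieces come from M, N and P, which are pairwise joinable
    joinable : substB (length Δ) P M ⋄ substB (length Δ) P N
    joinable = ⋄-mono (fvs-subst _ P M) (fvs-subst _ P N)
      (⋄-app (⋄-appʳ j jM) (⋄-appʳ (⋄-sym jN) jPP))
subst-wf Δ {P = P} (wlam {L₀} {M} wM d) wP dP jMP jPP =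
  wlam (proj₁ IH) (subst (_⪯ L₀) (sym (proj₂ IH)) d) , proj₂ IH
  where
    shifted : fvs (shift 0 P) ⊆ₗ fvs P
    shifted = ⊆-reflexive (fvs-shift 0 P)
    IH = subst-wf (L₀ ∷ Δ) wM (weaken [] wP) (trans (deg-shift 0 P) dP)
           (⋄-mono ⊆-refl shifted jMP)
           (⋄-mono shifted shifted jPP)

Invariant : List Index → Tm → Tm → Set
Invariant Γ M M' = WF Γ M' × deg M' ≡ deg M × fvs M' ⊆ₗ fvs M

SubjectReduction : (Tm → Tm → Set) → Set
SubjectReduction R = ∀ {Γ M M'} → R M M' → WF Γ M → Invariant Γ M M'

-- A β-redex is well formed only if its argument is self-joinable and has
-- the binder's degree, which is what subst-wf needs.
β-sr : SubjectReduction βbase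
β-sr (β {M = K} {N} e) (wapp (wlam wK _) wN _ j) =
  let (w , d) = subst-wf [] wK wN e j (self⋄ wN)
  in w , d , fvs-subst 0 N K

-- The body of an η-redex contains the shifted function, which strengthens.
η-sr : SubjectReduction ηbase
η-sr (η {M = M}) (wlam (wapp wS _ _ _) _) =
  strengthen [] M wS , sym (deg-shift 0 M) ,
  ⊆-trans (⊆-reflexive (sym (fvs-shift 0 M))) (xs⊆xs++ys _ _)

appL-sr : ∀ {Γ M M' N} → (WF Γ M → Invariant Γ M M') →
  WF Γ (app M N) → Invariant Γ (app M N) (app M' N)
appL-sr {N = N} sr (wapp wM wN d j) =
  let (w , e , s) = sr wM
  in wapp w wN (subst (_⪯ deg N) (sym e) d) (⋄-mono s ⊆-refl j) , e , ++⁺ˡ (fvs N) s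

compat-sr : ∀ {R} → SubjectReduction R → SubjectReduction (Compat R)
compat-sr sr (base s) w = sr s w
compat-sr sr (appL s) w = appL-sr (compat-sr sr s) w
compat-sr sr (appR {M} s) (wapp wM wN d j) =
  let (w , e , s') = compat-sr sr s wN
  in wapp wM w (subst (deg M ⪯_) (sym e) d) (⋄-mono ⊆-refl s' j) , refl , ++⁺ʳ (fvs M) s'
compat-sr sr (lamC {L} s) (wlam w d) =
  let (w' , e , s') = compat-sr sr s w
  in wlam w' (subst (_⪯ L) (sym e) d) , e , s'

h-sr : SubjectReduction _▷h_
h-sr (hβ e) = β-sr (β e)
h-sr (happ s) = appL-sr (h-sr s)

red-sr : ∀ r → SubjectReduction (r ⊢_▷_)
red-sr rβ = compat-sr β-sr
red-sr rβη (inj₁ s) = compat-sr β-sr s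
red-sr rβη (inj₂ s) = compat-sr η-sr s
red-sr rh = h-sr

red*-sr : ∀ r {M M'} → r ⊢ M ▷* M' → Term M → Invariant [] M M'
red*-sr r ε t = t , refl , ⊆-refl
red*-sr r (s ◅ ss) t =
  let (t₁ , e₁ , s₁) = red-sr r s t
      (t₂ , e₂ , s₂) = red*-sr r ss t₁
  in t₂ , trans e₂ e₁ , ⊆-trans s₂ s₁

red-appL : ∀ r {M M' N} → r ⊢ M ▷ M' → r ⊢ app M N ▷ app M' N
red-appL rβ s = appL s
red-appL rβη (inj₁ s) = inj₁ (appL s)
red-appL rβη (inj₂ s) = inj₂ (appL s)
red-appL rh s = happ s

red*-appL : ∀ r {M M' N} → r ⊢ M ▷* M' → r ⊢ app M N ▷* app M' N
red*-appL r {N = N} = gmap (λ M → app M N) (red-appL r)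

relabel : (Index → Index) → Tm → Tm
relabel f (var x L)  = var x (f L)
relabel f (bvar n L) = bvar n (f L)
relabel f (app M N)  = app (relabel f M) (relabel f N)
relabel f (lam L M)  = lam (f L) (relabel f M)

lift-relabel : ∀ i M → lift i M ≡ relabel (i ∷_) M
lift-relabel i (var x L) = refl
lift-relabel i (bvar n L) = refl
lift-relabel i (app M N) = cong₂ app (lift-relabel i M) (lift-relabel i N)
lift-relabel i (lam L M) = cong (lam (i ∷ L)) (lift-relabel i M)

tl : Index → Index
tl [] = []
tl (_ ∷ L) = L

unlift : Tm → Tm
unlift = relabel tl

unlift-lift : ∀ i M → unlift (lift i M) ≡ M
unlift-lift i (var x L) = refl
unlift-lift i (bvar n L) = refl
unlift-lift i (app M N) = cong₂ app (unlift-lift i M) (unlift-lift i N)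
unlift-lift i (lam L M) = cong (lam L) (unlift-lift i M)

lift-injective : ∀ i {M N} → lift i M ≡ lift i N → M ≡ N
lift-injective i {M} {N} e =
  trans (sym (unlift-lift i M)) (trans (cong unlift e) (unlift-lift i N))

deg-relabel : ∀ f M → deg (relabel f M) ≡ f (deg M)
deg-relabel f (var x L) = refl
deg-relabel f (bvar n L) = refl
deg-relabel f (app M N) = deg-relabel f M
deg-relabel f (lam L M) = deg-relabel f M

deg-lift : ∀ i M → deg (lift i M) ≡ i ∷ deg M
deg-lift i M = trans (cong deg (lift-relabel i M)) (deg-relabel (i ∷_) M)

fvs-relabel : ∀ f M → fvs (relabel f M) ≡ map (map₂ f) (fvs M)
fvs-relabel f (var x L) = refl
fvs-relabel f (bvar n L) = refl
fvs-relabel f (app M N) =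
  trans (cong₂ _++_ (fvs-relabel f M) (fvs-relabel f N))
        (sym (map-++ (map₂ f) (fvs M) (fvs N)))
fvs-relabel f (lam L M) = fvs-relabel f M

⋄-relabel : ∀ f {M N} → M ⋄ N → relabel f M ⋄ relabel f N
⋄-relabel f {M} {N} j x L K a b
  with ∈-map⁻ (map₂ f) (subst (_ ∈_) (fvs-relabel f M) a)
     | ∈-map⁻ (map₂ f) (subst (_ ∈_) (fvs-relabel f N) b)
... | (_ , L₀) , a₀ , refl | (_ , K₀) , b₀ , refl = cong f (j x L₀ K₀ a₀ b₀)

Monotone : (Index → Index) → Set
Monotone f = ∀ {L₁ L₂} → L₁ ⪯ L₂ → f L₁ ⪯ f L₂

tl-mono : Monotone tl
tl-mono {[]} (L₃ , refl) = tl L₃ , refl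
tl-mono {_ ∷ L₁} (L₃ , refl) = L₃ , refl

cons-mono : ∀ i → Monotone (i ∷_)
cons-mono i (L₃ , e) = L₃ , cong (i ∷_) e

∋-relabel : ∀ f {Γ n L} → Γ ∋ n ∶ L → map f Γ ∋ n ∶ f L
∋-relabel f here = here
∋-relabel f (there p) = there (∋-relabel f p)

wf-relabel : ∀ {f} → Monotone f → ∀ {Γ M} → WF Γ M → WF (map f Γ) (relabel f M)
wf-relabel mono wvar = wvar
wf-relabel {f} mono (wbvar p) = wbvar (∋-relabel f p)
wf-relabel {f} mono (wapp {M} {N} wM wN d j) =
  wapp (wf-relabel mono wM) (wf-relabel mono wN)
    (subst₂ _⪯_ (sym (deg-relabel f M)) (sym (deg-relabel f N)) (mono d))
    (⋄-relabel f {M} {N} j)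
wf-relabel {f} mono (wlam {L} {M} wM d) =
  wlam (wf-relabel mono wM) (subst (_⪯ f L) (sym (deg-relabel f M)) (mono d))

relabel-shift : ∀ f c M → relabel f (shift c M) ≡ shift c (relabel f M)
relabel-shift f c (var x L) = refl
relabel-shift f c (bvar n L) with n <ᵇ c
... | true  = refl
... | false = refl
relabel-shift f c (app M N) = cong₂ app (relabel-shift f c M) (relabel-shift f c N)
relabel-shift f c (lam L M) = cong (lam (f L)) (relabel-shift f (suc c) M)

relabel-subst : ∀ f k P M →
  relabel f (substB k P M) ≡ substB k (relabel f P) (relabel f M)
relabel-subst f k P (var x L) = refl
relabel-subst f k P (bvar n L) with n <ᵇ k | n ≡ᵇ k
... | true  | _     = refl
... | false | true  = refl
... | false | false = refl
relabel-subst f k P (app M N) = cong₂ app (relabel-subst f k P M) (relabel-subst f k P N)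
relabel-subst f k P (lam L M) = begin
  lam (f L) (relabel f (substB (suc k) (shift 0 P) M))
    ≡⟨ cong (lam (f L)) (relabel-subst f (suc k) (shift 0 P) M) ⟩
  lam (f L) (substB (suc k) (relabel f (shift 0 P)) (relabel f M))
    ≡⟨ cong (λ Q → lam (f L) (substB (suc k) Q (relabel f M))) (relabel-shift f 0 P) ⟩
  lam (f L) (substB (suc k) (shift 0 (relabel f P)) (relabel f M)) ∎
  where open ≡-Reasoning

relabel-apps : ∀ f M Ns → relabel f (apps M Ns) ≡ apps (relabel f M) (map (relabel f) Ns)
relabel-apps f M [] = refl
relabel-apps f M (N ∷ Ns) = relabel-apps f (app M N) Ns

β-relabel : ∀ f {M M'} → βbase M M' → βbase (relabel f M) (relabel f M')
β-relabel f (β {M = K} {N} e) rewrite relabel-subst f 0 N K =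
  β (trans (deg-relabel f N) (cong f e))

η-relabel : ∀ f {M M'} → ηbase M M' → ηbase (relabel f M) (relabel f M')
η-relabel f (η {M = M}) rewrite relabel-shift f 0 M = η

compat-relabel : ∀ f {R} → (∀ {M M'} → R M M' → R (relabel f M) (relabel f M')) →
  ∀ {M M'} → Compat R M M' → Compat R (relabel f M) (relabel f M')
compat-relabel f g (base s) = base (g s)
compat-relabel f g (appL s) = appL (compat-relabel f g s)
compat-relabel f g (appR s) = appR (compat-relabel f g s)
compat-relabel f g (lamC s) = lamC (compat-relabel f g s)

h-relabel : ∀ f {M M'} → M ▷h M' → relabel f M ▷h relabel f M'
h-relabel f (hβ {M = K} {N} e) rewrite relabel-subst f 0 N K =
  hβ (trans (deg-relabel f N) (cong f e))
h-relabel f (happ s) = happ (h-relabel f s)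

red-relabel : ∀ r f {M M'} → r ⊢ M ▷ M' → r ⊢ relabel f M ▷ relabel f M'
red-relabel rβ f s = compat-relabel f (β-relabel f) s
red-relabel rβη f (inj₁ s) = inj₁ (compat-relabel f (β-relabel f) s)
red-relabel rβη f (inj₂ s) = inj₂ (compat-relabel f (η-relabel f) s)
red-relabel rh f s = h-relabel f s

red*-relabel : ∀ r f {M M'} → r ⊢ M ▷* M' → r ⊢ relabel f M ▷* relabel f M'
red*-relabel r f = gmap (relabel f) (red-relabel r f)

data StartsWith (i : ℕ) : Index → Set where
  starts : ∀ L → StartsWith i (i ∷ L)

startsWith-⪯ : ∀ {i L₁ L₂} → StartsWith i L₁ → L₁ ⪯ L₂ → StartsWith i L₂
startsWith-⪯ (starts L) (L₃ , refl) = starts (L ++ L₃)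

AllStartWith : ℕ → List Index → Set
AllStartWith i Γ = ∀ {n L} → Γ ∋ n ∶ L → StartsWith i L

extend : ∀ {i L Γ} → StartsWith i L → AllStartWith i Γ → AllStartWith i (L ∷ Γ)
extend sL h here = sL
extend sL h (there p) = h p

-- Since every index of a well-formed term extends its degree (or a binder
-- index), a term of degree i ∷ K only carries indexes starting with i.
lift-unlift : ∀ {i Γ M} → WF Γ M → AllStartWith i Γ → StartsWith i (deg M) →
  M ≡ lift i (unlift M)
lift-unlift wvar h (starts L) = refl
lift-unlift (wbvar p) h s with h p
... | starts L = refl
lift-unlift (wapp wM wN d j) h s =
  cong₂ app (lift-unlift wM h s) (lift-unlift wN h (startsWith-⪯ s d))
lift-unlift (wlam wM d) h s with startsWith-⪯ s d
... | sL@(starts _) = cong (lam _) (lift-unlift wM (extend sL h) s)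

unlift-𝓜 : ∀ {i K M} → 𝓜^ (i ∷ K) M → 𝓜^ K (unlift M) × M ≡ lift i (unlift M)
unlift-𝓜 {i} {M = M} (t , dM) =
  (wf-relabel tl-mono t , trans (deg-relabel tl M) (cong tl dM)) ,
  lift-unlift t (λ ()) (subst (StartsWith i) (sym dM) (starts _))

lift-𝓜 : ∀ {i K N} → 𝓜^ K N → 𝓜^ (i ∷ K) (lift i N)
lift-𝓜 {i} {N = N} (t , dN) rewrite lift-relabel i N =
  wf-relabel (cons-mono i) t , trans (deg-relabel (i ∷_) N) (cong (i ∷_) dN)

deg-apps : ∀ M Ns → deg (apps M Ns) ≡ deg M
deg-apps M [] = refl
deg-apps M (N ∷ Ns) = deg-apps (app M N) Ns

apps-snoc : ∀ M Ns N → app (apps M Ns) N ≡ apps M (Ns ++ N ∷ [])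
apps-snoc M [] N = refl
apps-snoc M (N' ∷ Ns) N = apps-snoc (app M N') Ns N

𝓝⊆𝓜 : ∀ {x L} → 𝓝 x L ⊆ 𝓜^ L
𝓝⊆𝓜 {x} {L} (t , Ns , refl) = t , deg-apps (var x L) Ns

𝓝-app : ∀ {x L M N} → 𝓝 x L M → Term N → L ⪯ deg N → M ⋄ N → 𝓝 x L (app M N)
𝓝-app {x} {L} {N = N} (t , Ns , refl) tN d j =
  wapp t tN (subst (_⪯ deg N) (sym (deg-apps (var x L) Ns)) d) j ,
  Ns ++ N ∷ [] , apps-snoc (var x L) Ns N

𝓝-unlift : ∀ {x i K M} → 𝓝 x (i ∷ K) M → 𝓝 x K (unlift M) × M ≡ lift i (unlift M)
𝓝-unlift {x} {i} {K} n@(t , Ns , refl) =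
  let ((t' , _) , e) = unlift-𝓜 (𝓝⊆𝓜 n)
  in (t' , map unlift Ns , relabel-apps tl (var x (i ∷ K)) Ns) , e

fresh : FVs → ℕ
fresh [] = 0
fresh ((v₁ n , _) ∷ xs) = suc n + fresh xs
fresh ((v₂ n , _) ∷ xs) = fresh xs

fresh-bound : ∀ xs {n L} → (v₁ n , L) ∈ xs → n < fresh xs
fresh-bound ((v₁ m , _) ∷ xs) (here refl) = s≤s (m≤m+n m (fresh xs))
fresh-bound ((v₁ m , _) ∷ xs) (there a) =
  ≤-trans (fresh-bound xs a) (m≤n+m (fresh xs) (suc m))
fresh-bound ((v₂ m , _) ∷ xs) (there a) = fresh-bound xs a

fresh⋄ : ∀ M L → M ⋄ var (v₁ (fresh (fvs M))) L
fresh⋄ M L x L' K a (here refl) = ⊥-elim (<-irrefl refl (fresh-bound (fvs M) a))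

isT-deg : ∀ {T} → IsT T → tdeg T ≡ []
isT-deg (tatom a) = refl
isT-deg (tarr U T) = refl

module Interpretation {r : Red} (𝓘 : Interp r) where
  open Interp 𝓘

  Bounded : Ty → Index → Set
  Bounded U L = ((x : Var) → IsV₁ x → 𝓝 x L ⊆ ⟦ 𝓘 ⟧ U) × (⟦ 𝓘 ⟧ U ⊆ 𝓜^ L)

  bounds : (U : Ty) (L : Index) → WfTy U → tdeg U ≡ L → Bounded U L
  bounds (atom a) _ _ refl = I-neut a , I⊆𝓜∅ a
  bounds (ω L) _ _ refl = (λ _ _ → 𝓝⊆𝓜) , id
  bounds (U ⊓ V) L (w⊓ wU wV dUV) e =
    (λ x v n → proj₁ bU x v n , proj₁ bV x v n) , (λ m → proj₂ bU (proj₁ m))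
    where
      bU = bounds U L wU e
      bV = bounds V L wV (trans (sym dUV) e)
  bounds (ē i U) _ (wē wU) refl = neutral , below
    where
      bU = bounds U (tdeg U) wU refl
      neutral : ∀ x → IsV₁ x → 𝓝 x (i ∷ tdeg U) ⊆ ⟦ 𝓘 ⟧ (ē i U)
      neutral x v n = let (n' , e) = 𝓝-unlift n in _ , proj₁ bU x v n' , e
      below : ⟦ 𝓘 ⟧ (ē i U) ⊆ 𝓜^ (i ∷ tdeg U)
      below (_ , m , refl) = lift-𝓜 (proj₂ bU m)
  bounds (U ⇒ T) _ (warr wU wT iT) refl = neutral , below
    where
      bU = bounds U (tdeg U) wU refl
      bT = bounds T [] wT (isT-deg iT)
      neutral : ∀ x → IsV₁ x → 𝓝 x [] ⊆ ⟦ 𝓘 ⟧ (U ⇒ T)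
      neutral x v n =
        proj₁ n , λ N m j → proj₁ bT x v (𝓝-app n (proj₁ (proj₂ bU m)) (deg N , refl) j)
      -- apply M to a fresh variable, which lies in 𝓘(U)
      below : ⟦ 𝓘 ⟧ (U ⇒ T) ⊆ 𝓜^ []
      below {M} (t , f) =
        t , proj₂ (proj₂ bT (f _ (proj₁ bU _ (isV₁ _) (wvar , [] , refl)) (fresh⋄ M _)))

  -- Part (1a), by induction on U; the arrow case uses the bounds of (1b).
  saturated : (U : Ty) → WfTy U → Saturated r (⟦ 𝓘 ⟧ U)
  saturated (atom a) _ = I-sat a
  saturated (ω L) _ M M' t st (_ , d) = t , trans (sym (proj₁ (proj₂ (red*-sr r st t)))) d
  saturated (U ⊓ V) (w⊓ wU wV _) M M' t st (mU , mV) =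
    saturated U wU M M' t st mU , saturated V wV M M' t st mV
  saturated (U ⇒ T) w@(warr wU wT _) M M' t st m' = t , applied
    where
      sr = red*-sr r st t
      dM : deg M ≡ []
      dM = trans (sym (proj₁ (proj₂ sr))) (proj₂ (proj₂ (bounds (U ⇒ T) [] w refl) m'))
      -- app M N reduces to app M' N, which lies in 𝓘(T)
      applied : ∀ N → ⟦ 𝓘 ⟧ U N → M ⋄ N → ⟦ 𝓘 ⟧ T (app M N)
      applied N m j = saturated T wT (app M N) (app M' N)
        (wapp t (proj₁ (proj₂ (bounds U _ wU refl) m))
          (subst (_⪯ deg N) (sym dM) (deg N , refl)) j)
        (red*-appL r st) (proj₂ m' N m (⋄-mono (proj₂ (proj₂ sr)) ⊆-refl j))
  -- M ▷* lift i N' gives unlift M ▷* N', and M is the lift of unlift M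
  saturated (ē i U) (wē wU) M _ t st (N' , m' , refl) =
    unlift M , saturated U wU (unlift M) N' tU st' m' , e
    where
      dM : deg M ≡ i ∷ deg N'
      dM = trans (sym (proj₁ (proj₂ (red*-sr r st t)))) (deg-lift i N')
      tU = proj₁ (proj₁ (unlift-𝓜 (t , dM)))
      e = proj₂ (unlift-𝓜 (t , dM))
      st' : r ⊢ unlift M ▷* N'
      st' = subst (r ⊢ unlift M ▷*_) (unlift-lift i N') (red*-relabel r tl st)

  ≃-sound : ∀ {U V} → U ≃ V → ⟦ 𝓘 ⟧ U ≐ ⟦ 𝓘 ⟧ V
  ≃-sound (≃refl _) = id , id
  ≃-sound (≃sym e) = proj₂ (≃-sound e) , proj₁ (≃-sound e)
  ≃-sound (≃trans a b) =
    (λ m → proj₁ (≃-sound b) (proj₁ (≃-sound a) m)) ,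
    (λ m → proj₂ (≃-sound a) (proj₂ (≃-sound b) m))
  ≃-sound (⊓cong a b _) =
    (λ (x , y) → proj₁ (≃-sound a) x , proj₁ (≃-sound b) y) ,
    (λ (x , y) → proj₂ (≃-sound a) x , proj₂ (≃-sound b) y)
  ≃-sound (ēcong a) =
    (λ (N , x , e) → N , proj₁ (≃-sound a) x , e) ,
    (λ (N , x , e) → N , proj₂ (≃-sound a) x , e)
  ≃-sound (⇒cong a b _ _) =
    (λ (t , f) → t , λ N x j → proj₁ (≃-sound b) (f N (proj₂ (≃-sound a) x) j)) ,
    (λ (t , f) → t , λ N x j → proj₂ (≃-sound b) (f N (proj₁ (≃-sound a) x) j))
  ≃-sound (⊓comm _) = (λ (x , y) → y , x) , (λ (x , y) → y , x)
  ≃-sound (⊓assoc _) = (λ ((a , b) , c) → a , (b , c)) , (λ (a , (b , c)) → (a , b) , c)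
  ≃-sound (⊓idem _) = proj₁ , (λ m → m , m)
  -- the two preimages of a lift coincide, as lifting is injective
  ≃-sound (ēdist {i} {U₁} {U₂} _) =
    (λ (N , (a , b) , e) → (N , a , e) , (N , b , e)) ,
    (λ ((N₁ , a , e₁) , (N₂ , b , e₂)) →
      N₁ , (a , subst (⟦ 𝓘 ⟧ U₂) (lift-injective i (trans (sym e₂) e₁)) b) , e₁)
  ≃-sound (ωunit {L} {U} w e) = proj₂ , (λ m → proj₂ (bounds U L w e) m , m)
  ≃-sound ēω = lifted , (λ m → let (m' , e) = unlift-𝓜 m in _ , m' , e)
    where
      lifted : ∀ {i K} → ⟦ 𝓘 ⟧ (ē i (ω K)) ⊆ 𝓜^ (i ∷ K)
      lifted (_ , m , refl) = lift-𝓜 m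

  ⊑-sound : ∀ {U V} → U ⊑ V → ⟦ 𝓘 ⟧ U ⊆ ⟦ 𝓘 ⟧ V
  ⊑-sound (⊑≃ e) = proj₁ (≃-sound e)
  ⊑-sound (⊑refl _) = id
  ⊑-sound (⊑trans a b) m = ⊑-sound b (⊑-sound a m)
  ⊑-sound (⊓elim _) = proj₁
  ⊑-sound (⊓mono a b _ _) (x , y) = ⊑-sound a x , ⊑-sound b y
  ⊑-sound (⇒mono a b _ _) (t , f) = t , λ N x j → ⊑-sound b (f N (⊑-sound a x) j)
  ⊑-sound (ēmono a) (N , x , e) = N , ⊑-sound a x , e

lemma10 : (r : Red) (𝓘 : Interp r) →
    ((U : Ty) → WfTy U → Saturated r (⟦ 𝓘 ⟧ U)) ×
    ((U : Ty) (L : Index) → WfTy U → tdeg U ≡ L →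
      ((x : Var) → IsV₁ x → 𝓝 x L ⊆ ⟦ 𝓘 ⟧ U) × (⟦ 𝓘 ⟧ U ⊆ 𝓜^ L)) ×
    ((U V : Ty) → U ⊑ V → ⟦ 𝓘 ⟧ U ⊆ ⟦ 𝓘 ⟧ V)
lemma10 r 𝓘 = saturated , bounds , λ _ _ → ⊑-sound
  where open Interpretation 𝓘
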